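{- Let $n\ge 2$, let $\Phi$ be $B_n$, $C_n$ or $D_n$, and let ${\bf s}$ be the score sequence of some Coxeter tournament on the complete $\Phi$-graph. Then the Coxeter interchange graph ${\rm IntGr}(\Phi,{\bf s})$ is regular with degree \[ d(\Phi,{\bf s})=\frac{\|{\bf s}_\Phi\|^2-\|{\bf s}\|^2}{2}, \] where $\|\cdot\|$ is the Euclidean norm and ${\bf s}_\Phi$ is the standard score sequence. Equivalently, every Coxeter tournament with score sequence ${\bf s}$ contains exactly $d(\Phi,{\bf s})$ generators of type $\Phi$, where each neutral clover is counted twice.
   Context: Let ${\bf e}_1,\dots,{\bf e}_n$ be the standard basis of $\mathbb{R}^n$, and positive systems $B_n^+=\{{\bf e}_i\pm{\bf e}_j: i>j\}\cup\{{\bf e}_i\}$, $C_n^+=\{{\bf e}_i\pm{\bf e}_j:i>j\}\cup\{2{\bf e}_i\}$, $D_n^+=\{{\bf e}_i\pm{\bf e}_j:i>j\}$. A Coxeter tournament on the complete $\Phi$-graph assigns an outcome $w_{\bf e}\in\{0,1\}$ (won/lost) to each "game" ${\bf e}\in\Phi^+$: ${\bf e}_i-{\bf e}_j$ is a competitive game between $i$ and $j$ (won by $i$ if $w=1$, by $j$ if $w=0$), ${\bf e}_i+{\bf e}_j$ a collaborative game of $i,j$, ${\bf e}_i$ a half-edge solitaire game of $i$, $2{\bf e}_i$ a loop solitaire game of $i$. The score sequence of a set $X$ of such oriented games is $\sum_{{\bf e}\in X}(w_{\bf e}-1/2){\bf e}$; $X$ is neutral if this is ${\bf 0}$. The standard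 score sequence is ${\bf s}_\Phi=\sum_{{\bf e}\in\Phi^+}{\bf e}/2$. Generators (all neutral sets of games): for distinct players $i,j,k$, a cyclic triangle is the set of the three competitive games among $i,j,k$ when they are neutral (each of $i,j,k$ wins exactly one); a balanced triangle is a set consisting of one competitive game and two collaborative games on the three pairs of $\{i,j,k\}$, whose total score is zero (one collaborative game won, one lost, and the competitive game won by the player not in the won collaborative game). For distinct $i,j$: a neutral pair (type $B_n$ only) is a neutral set consisting of the two half-edge games of $i$ and $j$ together with either the competitive or the collaborative game between $i$ and $j$; a neutral clover (type $C_n$ only) is the set consisting of the competitive game between $i$ and $j$, the collaborative game of $i,j$, and the loop game of $i$, where $i$ wins the competitive game and the collaborative game is won and the loop is lost, or $i$ loses the competitive game, the collaborative game is lost and the loop is won. Generators of type $D_n$: cyclic and balanced triangles; of type $B_n$: these plus neutral pairs; of type $C_n$: these plus neutral clovers. For a tournament ${\mathcal T}$ and a set ${\mathcal X}$ of its games, ${\mathcal T}*{\mathcal X}$ is obtained by replacing $w_{\bf e}$ by $1-w_{\bf e}$ for ${\bf e}\in{\mathcal X}$. The Coxeter interchange graph ${\rm IntGr}(\Phi,{\bf s})$ is the multigraph with a vertex for each Coxeter tournament on the complete $\Phi$-graph with score sequence ${\bf s}$, where ${\mathcal T}_1,{\mathcal T}_2$ are joined if ${\mathcal T}_2={\mathcal T}_1*{\mathcal G}$ for a generator ${\mathcal G}$ of type $\Phi$ in ${\mathcal T}_1$, by a double edge if ${\mathcal G}$ is a clover and a single edge otherwise. -}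

module Defs where

open import Data.Bool using (Bool; true; false; if_then_else_; _∧_; _∨_; not)
open import Data.Nat as ℕ using (ℕ; _<ᵇ_)
open import Data.Fin as Fin using (Fin; toℕ)
open import Data.List using (List; []; _∷_; _++_; concatMap; map; foldr; allFin)
open import Data.Product using (_×_; _,_)
open import Data.Integer using (+_)
open import Relation.Nullary using (does)
open import Data.Rational using (ℚ; 0ℚ; 1ℚ; ½; -½; _+_; _-_; _*_; _/_)
import Data.Rational.Properties as ℚP

data RootSystem : Set where
  B C D : RootSystem

-- Games on players Fin n (the positive roots, used only with j < i):
--   comp i j  = e_i - e_j  (competitive game between i and j)
--   coll i j  = e_i + e_j  (collaborative game of i and j)
--   half i    = e_i        (half-edge solitaire game, type B only)
--   loop i    = 2 e_i      (loop solitaire game, type C only)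
data Game (n : ℕ) : Set where
  comp coll : Fin n → Fin n → Game n
  half loop : Fin n → Game n

_==_ : ∀ {n} → Fin n → Fin n → Bool
i == j = does (i Fin.≟ j)

δ : ∀ {n} → Fin n → Fin n → ℚ
δ i k = if i == k then 1ℚ else 0ℚ

vec : ∀ {n} → Game n → Fin n → ℚ
vec (comp i j) k = δ i k - δ j k
vec (coll i j) k = δ i k + δ j k
vec (half i)   k = δ i k
vec (loop i)   k = δ i k + δ i k

sumℚ : List ℚ → ℚ
sumℚ = foldr _+_ 0ℚ

pairs : (n : ℕ) → List (Fin n × Fin n)
pairs n = concatMap (λ i → concatMap (λ j → if toℕ j <ᵇ toℕ i then (i , j) ∷ [] else [])
                                      (allFin n)) (allFin n)

triples : (n : ℕ) → List (Fin n × Fin n × Fin n)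
triples n = concatMap (λ { (i , j) → concatMap (λ k → if toℕ k <ᵇ toℕ j then (i , j , k) ∷ [] else [])
                                                 (allFin n) }) (pairs n)

positiveRoots : RootSystem → (n : ℕ) → List (Game n)
positiveRoots Φ n =
  map (λ { (i , j) → comp i j }) (pairs n) ++
  map (λ { (i , j) → coll i j }) (pairs n) ++ extra Φ
  where
  extra : RootSystem → List (Game n)
  extra B = map half (allFin n)
  extra C = map loop (allFin n)
  extra D = []

-- A Coxeter tournament: an outcome w_e ∈ {0,1} (false/true) for each game.
-- (Only the values on the games of Φ⁺ are ever used.)
Tournament : ℕ → Set
Tournament n = Game n → Bool

outcome : Bool → ℚ
outcome true  = ½
outcome false = -½

scoreOf : ∀ {n} → Tournament n → List (Game n) → Fin n → ℚ
scoreOf T X k = sumℚ (map (λ g → outcome (T g) * vec g k) X)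

score : (Φ : RootSystem) → ∀ {n} → Tournament n → Fin n → ℚ
score Φ {n} T = scoreOf T (positiveRoots Φ n)

standardScore : RootSystem → (n : ℕ) → Fin n → ℚ
standardScore Φ n k = sumℚ (map (λ g → ½ * vec g k) (positiveRoots Φ n))

normSq : ∀ {n} → (Fin n → ℚ) → ℚ
normSq {n} s = sumℚ (map (λ k → s k * s k) (allFin n))

allB : ∀ {A : Set} → (A → Bool) → List A → Bool
allB p = foldr (λ x b → p x ∧ b) true

isNeutral : ∀ {n} → Tournament n → List (Game n) → Bool
isNeutral {n} T X = allB (λ k → does (scoreOf T X k ℚP.≟ 0ℚ)) (allFin n)

-- All possible generator sets of type Φ, each listed once, together with
-- the condition for being a generator in T and its edge multiplicity
-- (2 for clovers, 1 otherwise).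
generatorCandidates : RootSystem → ∀ {n} → Tournament n → List (ℕ × Bool)
generatorCandidates Φ {n} T =
  concatMap (λ { (i , j , k) →
      (1 , isNeutral T (comp i j ∷ comp j k ∷ comp i k ∷ [])) ∷
      (1 , isNeutral T (comp i j ∷ coll i k ∷ coll j k ∷ [])) ∷
      (1 , isNeutral T (comp i k ∷ coll i j ∷ coll j k ∷ [])) ∷
      (1 , isNeutral T (comp j k ∷ coll i j ∷ coll i k ∷ [])) ∷ [] })
    (triples n)
  ++ extra Φ
  where
  -- clover at i (loop of i) with partner j, competitive game c, collaborative game l;
  -- iWins says whether i wins c.
  clover : Bool → Game n → Game n → Game n → Bool
  clover iWins c l lp =
    (iWins ∧ T l ∧ not (T lp)) ∨ (not iWins ∧ not (T l) ∧ T lp)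
  extra : RootSystem → List (ℕ × Bool)
  extra B = concatMap (λ { (i , j) →
      (1 , isNeutral T (half i ∷ half j ∷ comp i j ∷ [])) ∷
      (1 , isNeutral T (half i ∷ half j ∷ coll i j ∷ [])) ∷ [] }) (pairs n)
  extra C = concatMap (λ { (i , j) →
      -- game comp i j is won by i iff T (comp i j) = true  (here j < i)
      (2 , clover (T (comp i j)) (comp i j) (coll i j) (loop i)) ∷
      (2 , clover (not (T (comp i j))) (comp i j) (coll i j) (loop j)) ∷ [] }) (pairs n)
  extra D = []

-- Degree of the vertex T in the multigraph IntGr(Φ, score Φ T):
-- one edge per generator G of T (to T * G), doubled for clovers.
intGrDegree : RootSystem → ∀ {n} → Tournament n → ℕ
intGrDegree Φ T = foldr (λ { (w , b) acc → if b then w ℕ.+ acc else acc }) 0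
                        (generatorCandidates Φ T)

ℕtoℚ : ℕ → ℚ
ℕtoℚ m = (+ m) / 1

dΦ : RootSystem → (n : ℕ) → (Fin n → ℚ) → ℚ
dΦ Φ n s = (normSq (standardScore Φ n) - normSq s) * ½

-- Write w_e ∈ {0,1} for the outcome of the game e. Then s_Φ - s = Σ (1 - w_e) e and
-- s_Φ + s = Σ w_e e, so ‖s_Φ‖² - ‖s‖² = Σ_k (s_Φ - s)_k (s_Φ + s)_k.  Split each coordinate
-- k into the contributions of the games against every other player m and of the solitaire
-- game of k; expanding the product turns the norm difference into a sum of terms attached
-- to pairs {k, m} and to triples {k, m, m'} of players (the solitaire parts of (s_Φ - s)_k
-- and (s_Φ + s)_k never multiply to anything nonzero).  Each such term only depends on the
-- outcomes of the at most six games among those two or three players, and checking all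
-- possibilities shows that it is twice the number of generators supported on them, clovers
-- counted twice.  Summing over all pairs and triples gives twice the degree.

module Submission where

open import Defs
open import Data.Nat using (ℕ; _≤_)
open import Relation.Binary.PropositionalEquality using (_≡_)

open import Algebra.Bundles using (Ring)
import Data.Rational.Properties as ℚP
open import Algebra.Properties.Semiring.Sum (Ring.semiring ℚP.+-*-ring)
  using (sum; sum-syntax; sum-cong-≗; ∑-distrib-+; ∑-comm; *-distribˡ-sum; *-distribʳ-sum; sum-replicate-zero)
open import Data.Bool using (Bool; true; false; if_then_else_; T; _∧_; _∨_; not)
open import Data.Bool.Properties using (T-∧; T-≡; ⇔→≡)
open import Data.Empty using (⊥-elim)
open import Data.Fin using (Fin; zero; suc; toℕ; _≟_; _<_)
open import Data.Fin.Patterns using (0F; 1F; 2F)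
open import Data.Fin.Properties using (<-cmp; <-irrefl; <-asym; <-trans)
import Data.Integer as ℤ
import Data.Integer.Properties as ℤP
open import Data.List using (List; []; _∷_; _++_; concatMap; map; foldr; allFin; tabulate)
import Data.List.Membership.DecPropositional as DecMembership
open import Data.List.Membership.Propositional using (_∈_; _∉_)
open import Data.List.Membership.Propositional.Properties using (∈-allFin)
open import Data.List.Properties using (map-tabulate)
open import Data.List.Relation.Unary.All as All using (All; []; _∷_)
open import Data.List.Relation.Unary.All.Properties using (¬Any⇒All¬)
open import Data.List.Relation.Unary.Any using (here; there)
open import Data.Nat as ℕ using (zero; suc; _<ᵇ_)
import Data.Nat.Coprimality as Coprime
import Data.Nat.Properties as ℕP
open import Data.Product using (_×_; _,_; proj₁; proj₂)
open import Data.Rational using (ℚ; mkℚ; 0ℚ; 1ℚ; ½; -½; _+_; _-_; _*_; -_)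
open import Data.Rational.Solver using (module +-*-Solver)
open import Data.Vec using (Vec; []; _∷_)
open import Function using (_∘_; mk⇔; Equivalence)
open import Relation.Binary.Definitions using (tri<; tri≈; tri>)
open import Relation.Binary.PropositionalEquality
  using (_≢_; refl; sym; trans; cong; cong₂; ≢-sym; module ≡-Reasoning)
open import Relation.Nullary using (yes; no)
open import Relation.Nullary.Decidable using (does; isYes; toWitness; dec-true; dec-false)
open import Relation.Nullary.Negation using (¬_)

open +-*-Solver
open ≡-Reasoning

when : Bool → ℚ → ℚ
when b x = if b then x else 0ℚ

sumOver : {A : Set} → List A → (A → ℚ) → ℚ
sumOver xs f = sumℚ (map f xs)

sumOver-++ : ∀ {A : Set} (xs ys : List A) (f : A → ℚ) →
  sumOver (xs ++ ys) f ≡ sumOver xs f + sumOver ys f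
sumOver-++ []       ys f = sym (ℚP.+-identityˡ _)
sumOver-++ (x ∷ xs) ys f = trans (cong (f x +_) (sumOver-++ xs ys f)) (sym (ℚP.+-assoc (f x) _ _))

sumOver-map : ∀ {A B : Set} (g : A → B) (xs : List A) (f : B → ℚ) →
  sumOver (map g xs) f ≡ sumOver xs (f ∘ g)
sumOver-map g []       f = refl
sumOver-map g (x ∷ xs) f = cong (f (g x) +_) (sumOver-map g xs f)

sumOver-concatMap : ∀ {A B : Set} (g : A → List B) (xs : List A) (f : B → ℚ) →
  sumOver (concatMap g xs) f ≡ sumOver xs (λ x → sumOver (g x) f)
sumOver-concatMap g []       f = refl
sumOver-concatMap g (x ∷ xs) f =
  trans (sumOver-++ (g x) (concatMap g xs) f) (cong (sumOver (g x) f +_) (sumOver-concatMap g xs f))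

sumOver-cong : ∀ {A : Set} (xs : List A) {f g : A → ℚ} → (∀ x → f x ≡ g x) → sumOver xs f ≡ sumOver xs g
sumOver-cong []       f≗g = refl
sumOver-cong (x ∷ xs) f≗g = cong₂ _+_ (f≗g x) (sumOver-cong xs f≗g)

sumOver-+ : ∀ {A : Set} (xs : List A) (f g : A → ℚ) →
  sumOver xs (λ x → f x + g x) ≡ sumOver xs f + sumOver xs g
sumOver-+ []       f g = refl
sumOver-+ (x ∷ xs) f g = trans (cong (f x + g x +_) (sumOver-+ xs f g))
  (solve 4 (λ a b c d → (a :+ b) :+ (c :+ d) := (a :+ c) :+ (b :+ d)) refl (f x) (g x) _ _)

sumOver-- : ∀ {A : Set} (xs : List A) (f g : A → ℚ) →
  sumOver xs (λ x → f x - g x) ≡ sumOver xs f - sumOver xs g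
sumOver-- []       f g = refl
sumOver-- (x ∷ xs) f g = trans (cong (f x - g x +_) (sumOver-- xs f g))
  (solve 4 (λ a b c d → (a :- b) :+ (c :- d) := (a :+ c) :- (b :+ d)) refl (f x) (g x) _ _)

sumℚ-tabulate : ∀ {n} (f : Fin n → ℚ) → sumℚ (tabulate f) ≡ sum f
sumℚ-tabulate {zero}  f = refl
sumℚ-tabulate {suc n} f = cong (f zero +_) (sumℚ-tabulate (f ∘ suc))

sumOver-allFin : ∀ {n} (f : Fin n → ℚ) → sumOver (allFin n) f ≡ ∑[ i < n ] f i
sumOver-allFin f = trans (cong sumℚ (map-tabulate (λ i → i) f)) (sumℚ-tabulate f)

sumOver-guard : ∀ {A : Set} (b : Bool) (x : A) (f : A → ℚ) →
  sumOver (if b then x ∷ [] else []) f ≡ when b (f x)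
sumOver-guard true  x f = ℚP.+-identityʳ (f x)
sumOver-guard false x f = refl

∑∑-allFin : ∀ {n} (f : Fin n → Fin n → ℚ) →
  sumOver (allFin n) (λ i → sumOver (allFin n) (f i)) ≡ ∑[ i < n ] ∑[ j < n ] f i j
∑∑-allFin {n} f = trans (sumOver-allFin {n} _) (sum-cong-≗ (λ i → sumOver-allFin (f i)))

when-+ : ∀ b x y → when b (x + y) ≡ when b x + when b y
when-+ true  x y = refl
when-+ false x y = refl

when-*ʳ : ∀ b x y → when b x * y ≡ when b (x * y)
when-*ʳ true  x y = refl
when-*ʳ false x y = ℚP.*-zeroˡ y

when-0 : ∀ b → when b 0ℚ ≡ 0ℚ
when-0 true  = refl
when-0 false = refl

when-cong : ∀ b {x y} → (b ≡ true → x ≡ y) → when b x ≡ when b y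
when-cong true  x≡y = x≡y refl
when-cong false x≡y = refl

when-∑ : ∀ {n} b (f : Fin n → ℚ) → when b (∑[ i < n ] f i) ≡ ∑[ i < n ] when b (f i)
when-∑ true  f = refl
when-∑ {n} false f = sym (sum-replicate-zero n)

∑-when-*ʳ : ∀ {n} (b : Fin n → Bool) (f : Fin n → ℚ) x →
  (∑[ i < n ] when (b i) (f i)) * x ≡ ∑[ i < n ] when (b i) (f i * x)
∑-when-*ʳ b f x =
  trans (*-distribʳ-sum x (λ i → when (b i) (f i))) (sum-cong-≗ (λ i → when-*ʳ (b i) (f i) x))

∑∑-distrib-+ : ∀ {n} (f g : Fin n → Fin n → ℚ) →
  ∑[ i < n ] ∑[ j < n ] (f i j + g i j) ≡ ∑[ i < n ] ∑[ j < n ] f i j + ∑[ i < n ] ∑[ j < n ] g i j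
∑∑-distrib-+ {n} f g =
  trans (sum-cong-≗ (λ i → ∑-distrib-+ (f i) (g i)))
        (∑-distrib-+ (λ i → ∑[ j < n ] f i j) (λ i → ∑[ j < n ] g i j))

∑-when-+ : ∀ {n} (b : Fin n → Bool) (f g : Fin n → ℚ) →
  ∑[ m < n ] when (b m) (f m + g m) ≡ ∑[ m < n ] when (b m) (f m) + ∑[ m < n ] when (b m) (g m)
∑-when-+ b f g =
  trans (sum-cong-≗ (λ m → when-+ (b m) (f m) (g m)))
        (∑-distrib-+ (λ m → when (b m) (f m)) (λ m → when (b m) (g m)))

_≺_ : ∀ {n} → Fin n → Fin n → Bool
i ≺ j = toℕ i <ᵇ toℕ j

≺-true : ∀ {n} {i j : Fin n} → i < j → (i ≺ j) ≡ true
≺-true {i = i} {j} = dec-true (toℕ i ℕP.<? toℕ j)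

≺-false : ∀ {n} {i j : Fin n} → ¬ i < j → (i ≺ j) ≡ false
≺-false {i = i} {j} = dec-false (toℕ i ℕP.<? toℕ j)

≺-asym : ∀ {n} {i j : Fin n} → i < j → (j ≺ i) ≡ false
≺-asym i<j = ≺-false (<-asym i<j)

≺-irrefl : ∀ {n} (i : Fin n) → (i ≺ i) ≡ false
≺-irrefl i = ≺-false {i = i} (<-irrefl refl)

≺⇒< : ∀ {n} (i j : Fin n) → (i ≺ j) ≡ true → i < j
≺⇒< i j i≺j = ℕP.<ᵇ⇒< (toℕ i) (toℕ j) (Equivalence.from T-≡ i≺j)

==-refl : ∀ {n} (i : Fin n) → (i == i) ≡ true
==-refl i = dec-true (i ≟ i) refl

==-≢ : ∀ {n} {i j : Fin n} → i ≢ j → (i == j) ≡ false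
==-≢ {i = i} {j} = dec-false (i ≟ j)

<⇒≢ : ∀ {n} {i j : Fin n} → i < j → i ≢ j
<⇒≢ i<j refl = <-irrefl refl i<j

pairs-sum : ∀ n (h : Fin n × Fin n → ℚ) →
  sumOver (pairs n) h ≡ ∑[ i < n ] ∑[ j < n ] when (j ≺ i) (h (i , j))
pairs-sum n h = begin
  sumOver (pairs n) h
    ≡⟨ sumOver-concatMap _ (allFin n) h ⟩
  sumOver (allFin n) (λ i → sumOver (concatMap (guarded i) (allFin n)) h)
    ≡⟨ sumOver-cong (allFin n) (λ i → sumOver-concatMap (guarded i) (allFin n) h) ⟩
  sumOver (allFin n) (λ i → sumOver (allFin n) (λ j → sumOver (guarded i j) h))
    ≡⟨ sumOver-cong (allFin n) (λ i → sumOver-cong (allFin n) (λ j → sumOver-guard (j ≺ i) (i , j) h)) ⟩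
  sumOver (allFin n) (λ i → sumOver (allFin n) (λ j → when (j ≺ i) (h (i , j))))
    ≡⟨ ∑∑-allFin {n} _ ⟩
  ∑[ i < n ] ∑[ j < n ] when (j ≺ i) (h (i , j))
    ∎
  where
  guarded : Fin n → Fin n → List (Fin n × Fin n)
  guarded i j = if j ≺ i then (i , j) ∷ [] else []

triples-sum : ∀ n (h : Fin n × Fin n × Fin n → ℚ) →
  sumOver (triples n) h ≡ ∑[ i < n ] ∑[ j < n ] when (j ≺ i) (∑[ k < n ] when (k ≺ j) (h (i , j , k)))
triples-sum n h = begin
  sumOver (triples n) h
    ≡⟨ sumOver-concatMap _ (pairs n) h ⟩
  sumOver (pairs n) (λ { (i , j) → sumOver (concatMap (guarded i j) (allFin n)) h })
    ≡⟨ pairs-sum n _ ⟩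
  ∑[ i < n ] ∑[ j < n ] when (j ≺ i) (sumOver (concatMap (guarded i j) (allFin n)) h)
    ≡⟨ sum-cong-≗ (λ i → sum-cong-≗ (λ j → cong (when (j ≺ i)) (inner i j))) ⟩
  ∑[ i < n ] ∑[ j < n ] when (j ≺ i) (∑[ k < n ] when (k ≺ j) (h (i , j , k)))
    ∎
  where
  guarded : Fin n → Fin n → Fin n → List (Fin n × Fin n × Fin n)
  guarded i j k = if k ≺ j then (i , j , k) ∷ [] else []
  inner : ∀ i j → sumOver (concatMap (guarded i j) (allFin n)) h ≡ ∑[ k < n ] when (k ≺ j) (h (i , j , k))
  inner i j = trans (sumOver-concatMap (guarded i j) (allFin n) h)
    (trans (sumOver-cong (allFin n) (λ k → sumOver-guard (k ≺ j) (i , j , k) h)) (sumOver-allFin {n} _))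

competitiveGames collaborativeGames : ∀ n → List (Game n)
competitiveGames   n = map (λ { (i , j) → comp i j }) (pairs n)
collaborativeGames n = map (λ { (i , j) → coll i j }) (pairs n)

solitaireGames : RootSystem → ∀ n → List (Game n)
solitaireGames B n = map half (allFin n)
solitaireGames C n = map loop (allFin n)
solitaireGames D n = []

positiveRoots-split : ∀ Φ n →
  positiveRoots Φ n ≡ competitiveGames n ++ (collaborativeGames n ++ solitaireGames Φ n)
positiveRoots-split B n = refl
positiveRoots-split C n = refl
positiveRoots-split D n = refl

pairPart : ∀ {n} → (Game n → ℚ) → Fin n → Fin n → ℚ
pairPart u k m = when (m ≺ k) (u (comp k m) + u (coll k m)) + when (k ≺ m) (- u (comp m k) + u (coll m k))

soloPart : RootSystem → ∀ {n} → (Game n → ℚ) → Fin n → ℚ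
soloPart B u k = u (half k)
soloPart C u k = u (loop k) + u (loop k)
soloPart D u k = 0ℚ

pairPart-diagonal : ∀ {n} (u : Game n → ℚ) k → pairPart u k k ≡ 0ℚ
pairPart-diagonal u k rewrite ≺-irrefl k = refl

sift : ∀ {n} (f : Fin n → ℚ) k → ∑[ i < n ] (f i * δ i k) ≡ f k
sift {suc n} f zero = begin
  f zero * 1ℚ + ∑[ i < n ] (f (suc i) * 0ℚ)
    ≡⟨ cong₂ _+_ (ℚP.*-identityʳ (f zero))
                 (trans (sum-cong-≗ (λ i → ℚP.*-zeroʳ (f (suc i)))) (sum-replicate-zero n)) ⟩
  f zero + 0ℚ
    ≡⟨ ℚP.+-identityʳ (f zero) ⟩
  f zero
    ∎
sift {suc n} f (suc k) = begin
  f zero * 0ℚ + ∑[ i < n ] (f (suc i) * δ i k)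
    ≡⟨ cong (_+ ∑[ i < n ] (f (suc i) * δ i k)) (ℚP.*-zeroʳ (f zero)) ⟩
  0ℚ + ∑[ i < n ] (f (suc i) * δ i k)
    ≡⟨ ℚP.+-identityˡ _ ⟩
  ∑[ i < n ] (f (suc i) * δ i k)
    ≡⟨ sift (f ∘ suc) k ⟩
  f (suc k)
    ∎

sift-outer : ∀ {n} (h : Fin n → Fin n → ℚ) k → ∑[ i < n ] ∑[ j < n ] (h i j * δ i k) ≡ ∑[ j < n ] h k j
sift-outer {n} h k =
  trans (sum-cong-≗ (λ i → sym (*-distribʳ-sum (δ i k) (h i)))) (sift (λ i → ∑[ j < n ] h i j) k)

sift-higher : ∀ {n} (h : Fin n → Fin n → ℚ) k →
  ∑[ i < n ] ∑[ j < n ] (when (j ≺ i) (h i j) * δ i k) ≡ ∑[ m < n ] when (m ≺ k) (h k m)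
sift-higher h = sift-outer (λ i j → when (j ≺ i) (h i j))

sift-lower : ∀ {n} (h : Fin n → Fin n → ℚ) k →
  ∑[ i < n ] ∑[ j < n ] (when (j ≺ i) (h i j) * δ j k) ≡ ∑[ m < n ] when (k ≺ m) (h m k)
sift-lower h k =
  trans (∑-comm (λ i j → when (j ≺ i) (h i j) * δ j k)) (sift-outer (λ j i → when (j ≺ i) (h i j)) k)

competitive-coordinate : ∀ {n} (u : Game n → ℚ) k →
  sumOver (competitiveGames n) (λ g → u g * vec g k)
  ≡ ∑[ m < n ] when (m ≺ k) (u (comp k m)) + ∑[ m < n ] when (k ≺ m) (- u (comp m k))
competitive-coordinate {n} u k = begin
  sumOver (competitiveGames n) (λ g → u g * vec g k)
    ≡⟨ trans (sumOver-map _ (pairs n) _) (pairs-sum n _) ⟩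
  ∑[ i < n ] ∑[ j < n ] when (j ≺ i) (u (comp i j) * (δ i k - δ j k))
    ≡⟨ sum-cong-≗ (λ i → sum-cong-≗ (λ j → split (j ≺ i) (u (comp i j)) (δ i k) (δ j k))) ⟩
  ∑[ i < n ] ∑[ j < n ] (when (j ≺ i) (u (comp i j)) * δ i k + when (j ≺ i) (- u (comp i j)) * δ j k)
    ≡⟨ ∑∑-distrib-+ (λ i j → when (j ≺ i) (u (comp i j)) * δ i k)
                    (λ i j → when (j ≺ i) (- u (comp i j)) * δ j k) ⟩
  _ ≡⟨ cong₂ _+_ (sift-higher (λ i j → u (comp i j)) k) (sift-lower (λ i j → - u (comp i j)) k) ⟩
  ∑[ m < n ] when (m ≺ k) (u (comp k m)) + ∑[ m < n ] when (k ≺ m) (- u (comp m k))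
    ∎
  where
  split : ∀ b x d e → when b (x * (d - e)) ≡ when b x * d + when b (- x) * e
  split true  x d e = solve 3 (λ x d e → x :* (d :- e) := x :* d :+ (:- x) :* e) refl x d e
  split false x d e = solve 2 (λ d e → con 0ℚ := con 0ℚ :* d :+ con 0ℚ :* e) refl d e

collaborative-coordinate : ∀ {n} (u : Game n → ℚ) k →
  sumOver (collaborativeGames n) (λ g → u g * vec g k)
  ≡ ∑[ m < n ] when (m ≺ k) (u (coll k m)) + ∑[ m < n ] when (k ≺ m) (u (coll m k))
collaborative-coordinate {n} u k = begin
  sumOver (collaborativeGames n) (λ g → u g * vec g k)
    ≡⟨ trans (sumOver-map _ (pairs n) _) (pairs-sum n _) ⟩
  ∑[ i < n ] ∑[ j < n ] when (j ≺ i) (u (coll i j) * (δ i k + δ j k))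
    ≡⟨ sum-cong-≗ (λ i → sum-cong-≗ (λ j → split (j ≺ i) (u (coll i j)) (δ i k) (δ j k))) ⟩
  ∑[ i < n ] ∑[ j < n ] (when (j ≺ i) (u (coll i j)) * δ i k + when (j ≺ i) (u (coll i j)) * δ j k)
    ≡⟨ ∑∑-distrib-+ (λ i j → when (j ≺ i) (u (coll i j)) * δ i k)
                    (λ i j → when (j ≺ i) (u (coll i j)) * δ j k) ⟩
  _ ≡⟨ cong₂ _+_ (sift-higher (λ i j → u (coll i j)) k) (sift-lower (λ i j → u (coll i j)) k) ⟩
  ∑[ m < n ] when (m ≺ k) (u (coll k m)) + ∑[ m < n ] when (k ≺ m) (u (coll m k))
    ∎
  where
  split : ∀ b x d e → when b (x * (d + e)) ≡ when b x * d + when b x * e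
  split true  x d e = ℚP.*-distribˡ-+ x d e
  split false x d e = solve 2 (λ d e → con 0ℚ := con 0ℚ :* d :+ con 0ℚ :* e) refl d e

solitaire-coordinate : ∀ Φ {n} (u : Game n → ℚ) k →
  sumOver (solitaireGames Φ n) (λ g → u g * vec g k) ≡ soloPart Φ u k
solitaire-coordinate B {n} u k =
  trans (sumOver-map half (allFin n) _) (trans (sumOver-allFin {n} _) (sift (u ∘ half) k))
solitaire-coordinate C {n} u k = begin
  sumOver (map loop (allFin n)) (λ g → u g * vec g k)
    ≡⟨ trans (sumOver-map loop (allFin n) _) (sumOver-allFin {n} _) ⟩
  ∑[ i < n ] (u (loop i) * (δ i k + δ i k))
    ≡⟨ sum-cong-≗ (λ i → ℚP.*-distribˡ-+ (u (loop i)) (δ i k) (δ i k)) ⟩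
  ∑[ i < n ] (u (loop i) * δ i k + u (loop i) * δ i k)
    ≡⟨ ∑-distrib-+ (λ i → u (loop i) * δ i k) (λ i → u (loop i) * δ i k) ⟩
  _ ≡⟨ cong₂ _+_ (sift (u ∘ loop) k) (sift (u ∘ loop) k) ⟩
  u (loop k) + u (loop k)
    ∎
solitaire-coordinate D u k = refl

positiveRoots-coordinate : ∀ Φ {n} (u : Game n → ℚ) k →
  sumOver (positiveRoots Φ n) (λ g → u g * vec g k) ≡ ∑[ m < n ] pairPart u k m + soloPart Φ u k
positiveRoots-coordinate Φ {n} u k = begin
  sumOver (positiveRoots Φ n) F
    ≡⟨ cong (λ xs → sumOver xs F) (positiveRoots-split Φ n) ⟩
  sumOver (competitiveGames n ++ (collaborativeGames n ++ solitaireGames Φ n)) F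
    ≡⟨ trans (sumOver-++ (competitiveGames n) _ F)
             (cong (sumOver (competitiveGames n) F +_) (sumOver-++ (collaborativeGames n) _ F)) ⟩
  sumOver (competitiveGames n) F + (sumOver (collaborativeGames n) F + sumOver (solitaireGames Φ n) F)
    ≡⟨ cong₂ _+_ (competitive-coordinate u k)
                 (cong₂ _+_ (collaborative-coordinate u k) (solitaire-coordinate Φ u k)) ⟩
  (c↓ + c↑) + ((l↓ + l↑) + soloPart Φ u k)
    ≡⟨ solve 5 (λ c↓ c↑ l↓ l↑ s →
                 (c↓ :+ c↑) :+ ((l↓ :+ l↑) :+ s) := ((c↓ :+ l↓) :+ (c↑ :+ l↑)) :+ s)
             refl c↓ c↑ l↓ l↑ (soloPart Φ u k) ⟩
  ((c↓ + l↓) + (c↑ + l↑)) + soloPart Φ u k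
    ≡⟨ cong (_+ soloPart Φ u k) (sym pairPart-sum) ⟩
  ∑[ m < n ] pairPart u k m + soloPart Φ u k
    ∎
  where
  F : Game n → ℚ
  F g = u g * vec g k
  c↓ c↑ l↓ l↑ : ℚ
  c↓ = ∑[ m < n ] when (m ≺ k) (u (comp k m))
  c↑ = ∑[ m < n ] when (k ≺ m) (- u (comp m k))
  l↓ = ∑[ m < n ] when (m ≺ k) (u (coll k m))
  l↑ = ∑[ m < n ] when (k ≺ m) (u (coll m k))
  pairPart-sum : ∑[ m < n ] pairPart u k m ≡ (c↓ + l↓) + (c↑ + l↑)
  pairPart-sum = trans (∑-distrib-+ (λ m → when (m ≺ k) (u (comp k m) + u (coll k m)))
                                    (λ m → when (k ≺ m) (- u (comp m k) + u (coll m k))))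
    (cong₂ _+_ (∑-when-+ (_≺ k) _ _) (∑-when-+ (k ≺_) _ _))

-- The norm difference as a sum over pairs and triples of players

won lost : Bool → ℚ
won  b = if b then 1ℚ else 0ℚ
lost b = if b then 0ℚ else 1ℚ

standard-minus-score : ∀ Φ {n} (τ : Tournament n) k →
  standardScore Φ n k - score Φ τ k ≡ sumOver (positiveRoots Φ n) (λ g → lost (τ g) * vec g k)
standard-minus-score Φ {n} τ k = trans (sym (sumOver-- (positiveRoots Φ n) _ _))
  (sumOver-cong (positiveRoots Φ n) (λ g → pointwise (τ g) (vec g k)))
  where
  pointwise : ∀ b v → ½ * v - outcome b * v ≡ lost b * v
  pointwise true  v = solve 1 (λ v → con ½ :* v :- con ½ :* v := con 0ℚ :* v) refl v
  pointwise false v = solve 1 (λ v → con ½ :* v :- con -½ :* v := con 1ℚ :* v) refl v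

standard-plus-score : ∀ Φ {n} (τ : Tournament n) k →
  standardScore Φ n k + score Φ τ k ≡ sumOver (positiveRoots Φ n) (λ g → won (τ g) * vec g k)
standard-plus-score Φ {n} τ k = trans (sym (sumOver-+ (positiveRoots Φ n) _ _))
  (sumOver-cong (positiveRoots Φ n) (λ g → pointwise (τ g) (vec g k)))
  where
  pointwise : ∀ b v → ½ * v + outcome b * v ≡ won b * v
  pointwise true  v = solve 1 (λ v → con ½ :* v :+ con ½ :* v := con 1ℚ :* v) refl v
  pointwise false v = solve 1 (λ v → con ½ :* v :+ con -½ :* v := con 0ℚ :* v) refl v

solo-lost-won : ∀ Φ {n} (τ : Tournament n) k → soloPart Φ (lost ∘ τ) k * soloPart Φ (won ∘ τ) k ≡ 0ℚ
solo-lost-won B τ k with τ (half k)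
... | true  = refl
... | false = refl
solo-lost-won C τ k with τ (loop k)
... | true  = refl
... | false = refl
solo-lost-won D τ k = refl

∑-off-diagonal : ∀ {n} (f : Fin n → Fin n → ℚ) →
  ∑[ i < n ] ∑[ j < n ] f i j ≡ ∑[ i < n ] f i i + ∑[ i < n ] ∑[ j < n ] (if j == i then 0ℚ else f i j)
∑-off-diagonal {n} f = begin
  ∑[ i < n ] ∑[ j < n ] f i j
    ≡⟨ sum-cong-≗ (λ i → sum-cong-≗ (λ j → pointwise (j == i) (f i j))) ⟩
  ∑[ i < n ] ∑[ j < n ] (f i j * δ j i + off i j)
    ≡⟨ ∑∑-distrib-+ (λ i j → f i j * δ j i) off ⟩
  ∑[ i < n ] ∑[ j < n ] (f i j * δ j i) + ∑[ i < n ] ∑[ j < n ] off i j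
    ≡⟨ cong (_+ ∑[ i < n ] ∑[ j < n ] off i j) (sum-cong-≗ (λ i → sift (f i) i)) ⟩
  ∑[ i < n ] f i i + ∑[ i < n ] ∑[ j < n ] off i j
    ∎
  where
  off : Fin n → Fin n → ℚ
  off i j = if j == i then 0ℚ else f i j
  pointwise : ∀ b x → x ≡ x * (if b then 1ℚ else 0ℚ) + (if b then 0ℚ else x)
  pointwise true  x = solve 1 (λ x → x := x :* con 1ℚ :+ con 0ℚ) refl x
  pointwise false x = solve 1 (λ x → x := x :* con 0ℚ :+ x) refl x

module _ {n : ℕ} (τ : Tournament n) where

  lostPart wonPart : Fin n → Fin n → ℚ
  lostPart = pairPart (lost ∘ τ)
  wonPart  = pairPart (won ∘ τ)

  pairTerm : RootSystem → Fin n → Fin n → ℚ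
  pairTerm Φ k m = lostPart k m * wonPart k m
                 + (lostPart k m * soloPart Φ (won ∘ τ) k + soloPart Φ (lost ∘ τ) k * wonPart k m)

  tripleTerm : Fin n → Fin n → Fin n → ℚ
  tripleTerm k m m' = if m' == m then 0ℚ else lostPart k m * wonPart k m'

module _ (Φ : RootSystem) {n : ℕ} (τ : Tournament n) where

  square-difference : ∀ k →
    standardScore Φ n k * standardScore Φ n k - score Φ τ k * score Φ τ k
    ≡ ∑[ m < n ] pairTerm τ Φ k m + ∑[ m < n ] ∑[ m' < n ] tripleTerm τ k m m'
  square-difference k = begin
    a * a - b * b
      ≡⟨ solve 2 (λ a b → a :* a :- b :* b := (a :- b) :* (a :+ b)) refl a b ⟩
    (a - b) * (a + b)
      ≡⟨ cong₂ _*_ (trans (standard-minus-score Φ τ k) (positiveRoots-coordinate Φ (lost ∘ τ) k))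
                   (trans (standard-plus-score Φ τ k) (positiveRoots-coordinate Φ (won ∘ τ) k)) ⟩
    (L + ℓ) * (W + w)
      ≡⟨ solve 4 (λ L ℓ W w → (L :+ ℓ) :* (W :+ w) := L :* W :+ (L :* w :+ ℓ :* W) :+ ℓ :* w)
                 refl L ℓ W w ⟩
    L * W + (L * w + ℓ * W) + ℓ * w
      ≡⟨ cong₂ _+_ (cong₂ _+_ LW (cross-terms)) (solo-lost-won Φ τ k) ⟩
    (Diag + Off) + ∑[ m < n ] (lostPart τ k m * w + ℓ * wonPart τ k m) + 0ℚ
      ≡⟨ solve 3 (λ D O X → (D :+ O) :+ X :+ con 0ℚ := (D :+ X) :+ O) refl Diag Off _ ⟩
    (Diag + ∑[ m < n ] (lostPart τ k m * w + ℓ * wonPart τ k m)) + Off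
      ≡⟨ cong (_+ Off) (sym (∑-distrib-+ (λ m → lostPart τ k m * wonPart τ k m) _)) ⟩
    ∑[ m < n ] pairTerm τ Φ k m + Off
      ∎
    where
    a b L W ℓ w Diag Off : ℚ
    a = standardScore Φ n k
    b = score Φ τ k
    L = ∑[ m < n ] lostPart τ k m
    W = ∑[ m < n ] wonPart τ k m
    ℓ = soloPart Φ (lost ∘ τ) k
    w = soloPart Φ (won ∘ τ) k
    Diag = ∑[ m < n ] (lostPart τ k m * wonPart τ k m)
    Off = ∑[ m < n ] ∑[ m' < n ] tripleTerm τ k m m'
    LW : L * W ≡ Diag + Off
    LW = begin
      L * W
        ≡⟨ *-distribʳ-sum W (lostPart τ k) ⟩
      ∑[ m < n ] (lostPart τ k m * W)
        ≡⟨ sum-cong-≗ (λ m → *-distribˡ-sum (lostPart τ k m) (wonPart τ k)) ⟩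
      ∑[ m < n ] ∑[ m' < n ] (lostPart τ k m * wonPart τ k m')
        ≡⟨ ∑-off-diagonal (λ m m' → lostPart τ k m * wonPart τ k m') ⟩
      Diag + Off
        ∎
    cross-terms : L * w + ℓ * W ≡ ∑[ m < n ] (lostPart τ k m * w + ℓ * wonPart τ k m)
    cross-terms = sym (trans (∑-distrib-+ (λ m → lostPart τ k m * w) (λ m → ℓ * wonPart τ k m))
      (cong₂ _+_ (sym (*-distribʳ-sum w (lostPart τ k))) (sym (*-distribˡ-sum ℓ (wonPart τ k)))))

  norm-difference :
    normSq (standardScore Φ n) - normSq (score Φ τ)
    ≡ ∑[ k < n ] ∑[ m < n ] pairTerm τ Φ k m + ∑[ k < n ] ∑[ m < n ] ∑[ m' < n ] tripleTerm τ k m m'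
  norm-difference = begin
    normSq (standardScore Φ n) - normSq (score Φ τ)
      ≡⟨ sym (sumOver-- (allFin n) _ _) ⟩
    sumOver (allFin n) (λ k → standardScore Φ n k * standardScore Φ n k - score Φ τ k * score Φ τ k)
      ≡⟨ sumOver-allFin {n} _ ⟩
    ∑[ k < n ] (standardScore Φ n k * standardScore Φ n k - score Φ τ k * score Φ τ k)
      ≡⟨ sum-cong-≗ square-difference ⟩
    ∑[ k < n ] (∑[ m < n ] pairTerm τ Φ k m + ∑[ m < n ] ∑[ m' < n ] tripleTerm τ k m m')
      ≡⟨ ∑-distrib-+ (λ k → ∑[ m < n ] pairTerm τ Φ k m)
                     (λ k → ∑[ m < n ] ∑[ m' < n ] tripleTerm τ k m m') ⟩
    ∑[ k < n ] ∑[ m < n ] pairTerm τ Φ k m + ∑[ k < n ] ∑[ m < n ] ∑[ m' < n ] tripleTerm τ k m m'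
      ∎

split-by-order : ∀ {n} (k m : Fin n) x → (k ≡ m → x ≡ 0ℚ) → x ≡ when (m ≺ k) x + when (k ≺ m) x
split-by-order k m x diagonal with <-cmp m k
... | tri< m<k _ _ rewrite ≺-true m<k | ≺-asym m<k = sym (ℚP.+-identityʳ x)
... | tri> _ _ k<m rewrite ≺-true k<m | ≺-asym k<m = sym (ℚP.+-identityˡ x)
... | tri≈ _ refl _ rewrite ≺-irrefl k = diagonal refl

∑-pairs : ∀ {n} (p : Fin n → Fin n → ℚ) → (∀ k → p k k ≡ 0ℚ) →
  ∑[ k < n ] ∑[ m < n ] p k m ≡ ∑[ i < n ] ∑[ j < n ] when (j ≺ i) (p i j + p j i)
∑-pairs {n} p diagonal = begin
  ∑[ k < n ] ∑[ m < n ] p k m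
    ≡⟨ sum-cong-≗ (λ k → sum-cong-≗ (λ m → split-by-order k m (p k m) λ { refl → diagonal k })) ⟩
  ∑[ k < n ] ∑[ m < n ] (when (m ≺ k) (p k m) + when (k ≺ m) (p k m))
    ≡⟨ ∑∑-distrib-+ (λ k m → when (m ≺ k) (p k m)) (λ k m → when (k ≺ m) (p k m)) ⟩
  ∑[ k < n ] ∑[ m < n ] when (m ≺ k) (p k m) + ∑[ k < n ] ∑[ m < n ] when (k ≺ m) (p k m)
    ≡⟨ cong (∑[ k < n ] ∑[ m < n ] when (m ≺ k) (p k m) +_) (∑-comm (λ k m → when (k ≺ m) (p k m))) ⟩
  ∑[ i < n ] ∑[ j < n ] when (j ≺ i) (p i j) + ∑[ i < n ] ∑[ j < n ] when (j ≺ i) (p j i)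
    ≡⟨ sym (∑∑-distrib-+ (λ i j → when (j ≺ i) (p i j)) (λ i j → when (j ≺ i) (p j i))) ⟩
  ∑[ i < n ] ∑[ j < n ] (when (j ≺ i) (p i j) + when (j ≺ i) (p j i))
    ≡⟨ sum-cong-≗ (λ i → sum-cong-≗ (λ j → sym (when-+ (j ≺ i) (p i j) (p j i)))) ⟩
  ∑[ i < n ] ∑[ j < n ] when (j ≺ i) (p i j + p j i)
    ∎

∑₃ : ∀ {n} → (Fin n → Fin n → Fin n → ℚ) → ℚ
∑₃ {n} f = ∑[ a < n ] ∑[ b < n ] ∑[ c < n ] f a b c

∑₃-+ : ∀ {n} (f g : Fin n → Fin n → Fin n → ℚ) →
  ∑₃ (λ a b c → f a b c + g a b c) ≡ ∑₃ f + ∑₃ g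
∑₃-+ {n} f g = trans (sum-cong-≗ (λ a → ∑∑-distrib-+ (f a) (g a)))
  (∑-distrib-+ (λ a → ∑[ b < n ] ∑[ c < n ] f a b c) (λ a → ∑[ b < n ] ∑[ c < n ] g a b c))

∑₃-swap₁₂ : ∀ {n} (f : Fin n → Fin n → Fin n → ℚ) → ∑₃ f ≡ ∑₃ (λ a b c → f b a c)
∑₃-swap₁₂ {n} f = ∑-comm (λ a b → ∑[ c < n ] f a b c)

∑₃-swap₂₃ : ∀ {n} (f : Fin n → Fin n → Fin n → ℚ) → ∑₃ f ≡ ∑₃ (λ a b c → f a c b)
∑₃-swap₂₃ f = sum-cong-≗ (λ a → ∑-comm (f a))

sorted : ∀ {n} → Fin n → Fin n → Fin n → ℚ → ℚ
sorted a b c x = when (b ≺ a) (when (c ≺ b) x)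

sorted-0 : ∀ {n} (a b c : Fin n) → sorted a b c 0ℚ ≡ 0ℚ
sorted-0 a b c = trans (cong (when (b ≺ a)) (when-0 (c ≺ b))) (when-0 (b ≺ a))

orderings : ∀ {n} → Fin n → Fin n → Fin n → ℚ → ℚ
orderings k m m' x = sorted k m m' x + (sorted k m' m x + (sorted m k m' x
                   + (sorted m m' k x + (sorted m' k m x + sorted m' m k x))))

orderings-0 : ∀ {n} (k m m' : Fin n) → orderings k m m' 0ℚ ≡ 0ℚ
orderings-0 k m m'
  rewrite sorted-0 k m m' | sorted-0 k m' m | sorted-0 m k m'
        | sorted-0 m m' k | sorted-0 m' k m | sorted-0 m' m k = refl

split-by-orderings : ∀ {n} (k m m' : Fin n) x →
  (k ≡ m → x ≡ 0ℚ) → (k ≡ m' → x ≡ 0ℚ) → (m ≡ m' → x ≡ 0ℚ) → x ≡ orderings k m m' x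
split-by-orderings k m m' x k≡m k≡m' m≡m'
  with <-cmp k m | <-cmp k m' | <-cmp m m'
... | tri≈ _ e _ | _ | _ rewrite k≡m e = sym (orderings-0 k m m')
... | tri< _ _ _ | tri≈ _ e _ | _ rewrite k≡m' e = sym (orderings-0 k m m')
... | tri> _ _ _ | tri≈ _ e _ | _ rewrite k≡m' e = sym (orderings-0 k m m')
... | tri< _ _ _ | tri< _ _ _ | tri≈ _ e _ rewrite m≡m' e = sym (orderings-0 k m m')
... | tri< _ _ _ | tri> _ _ _ | tri≈ _ e _ rewrite m≡m' e = sym (orderings-0 k m m')
... | tri> _ _ _ | tri< _ _ _ | tri≈ _ e _ rewrite m≡m' e = sym (orderings-0 k m m')
... | tri> _ _ _ | tri> _ _ _ | tri≈ _ e _ rewrite m≡m' e = sym (orderings-0 k m m')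
... | tri< k<m _ _ | tri> _ _ m'<k | tri< m<m' _ _ = ⊥-elim (<-irrefl refl (<-trans (<-trans k<m m<m') m'<k))
... | tri> _ _ m<k | tri< k<m' _ _ | tri> _ _ m'<m = ⊥-elim (<-irrefl refl (<-trans (<-trans k<m' m'<m) m<k))
... | tri< p _ _ | tri< q _ _ | tri< r _ _
  rewrite ≺-true p | ≺-asym p | ≺-true q | ≺-asym q | ≺-true r | ≺-asym r =
  solve 1 (λ x → x := con 0ℚ :+ (con 0ℚ :+ (con 0ℚ :+ (con 0ℚ :+ (con 0ℚ :+ x))))) refl x
... | tri< p _ _ | tri< q _ _ | tri> _ _ r
  rewrite ≺-true p | ≺-asym p | ≺-true q | ≺-asym q | ≺-true r | ≺-asym r =
  solve 1 (λ x → x := con 0ℚ :+ (con 0ℚ :+ (con 0ℚ :+ (x :+ (con 0ℚ :+ con 0ℚ))))) refl x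
... | tri< p _ _ | tri> _ _ q | tri> _ _ r
  rewrite ≺-true p | ≺-asym p | ≺-true q | ≺-asym q | ≺-true r | ≺-asym r =
  solve 1 (λ x → x := con 0ℚ :+ (con 0ℚ :+ (x :+ (con 0ℚ :+ (con 0ℚ :+ con 0ℚ))))) refl x
... | tri> _ _ p | tri< q _ _ | tri< r _ _
  rewrite ≺-true p | ≺-asym p | ≺-true q | ≺-asym q | ≺-true r | ≺-asym r =
  solve 1 (λ x → x := con 0ℚ :+ (con 0ℚ :+ (con 0ℚ :+ (con 0ℚ :+ (x :+ con 0ℚ))))) refl x
... | tri> _ _ p | tri> _ _ q | tri< r _ _
  rewrite ≺-true p | ≺-asym p | ≺-true q | ≺-asym q | ≺-true r | ≺-asym r =
  solve 1 (λ x → x := con 0ℚ :+ (x :+ (con 0ℚ :+ (con 0ℚ :+ (con 0ℚ :+ con 0ℚ))))) refl x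
... | tri> _ _ p | tri> _ _ q | tri> _ _ r
  rewrite ≺-true p | ≺-asym p | ≺-true q | ≺-asym q | ≺-true r | ≺-asym r =
  solve 1 (λ x → x := x :+ (con 0ℚ :+ (con 0ℚ :+ (con 0ℚ :+ (con 0ℚ :+ con 0ℚ))))) refl x

symmetrize : ∀ {n} → (Fin n → Fin n → Fin n → ℚ) → Fin n → Fin n → Fin n → ℚ
symmetrize q a b c = q a b c + (q a c b + (q b a c + (q c a b + (q b c a + q c b a))))

∑₃-+₆ : ∀ {n} (f₁ f₂ f₃ f₄ f₅ f₆ : Fin n → Fin n → Fin n → ℚ) →
  ∑₃ (λ a b c → f₁ a b c + (f₂ a b c + (f₃ a b c + (f₄ a b c + (f₅ a b c + f₆ a b c)))))
  ≡ ∑₃ f₁ + (∑₃ f₂ + (∑₃ f₃ + (∑₃ f₄ + (∑₃ f₅ + ∑₃ f₆))))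
∑₃-+₆ f₁ f₂ f₃ f₄ f₅ f₆ =
  trans (∑₃-+ f₁ _) (cong (∑₃ f₁ +_)
  (trans (∑₃-+ f₂ _) (cong (∑₃ f₂ +_)
  (trans (∑₃-+ f₃ _) (cong (∑₃ f₃ +_)
  (trans (∑₃-+ f₄ _) (cong (∑₃ f₄ +_) (∑₃-+ f₅ f₆))))))))

∑-triples : ∀ {n} (q : Fin n → Fin n → Fin n → ℚ) →
  (∀ k m → q k k m ≡ 0ℚ) → (∀ k m → q k m k ≡ 0ℚ) → (∀ k m → q k m m ≡ 0ℚ) →
  ∑₃ q ≡ ∑[ a < n ] ∑[ b < n ] when (b ≺ a) (∑[ c < n ] when (c ≺ b) (symmetrize q a b c))
∑-triples {n} q qkkm qkmk qkmm = begin
  ∑₃ q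
    ≡⟨ sum-cong-≗ (λ k → sum-cong-≗ (λ m → sum-cong-≗ (λ m' → split-by-orderings k m m' (q k m m')
         (λ { refl → qkkm k m' }) (λ { refl → qkmk k m }) (λ { refl → qkmm k m }))))  ⟩
  ∑₃ (λ k m m' → orderings k m m' (q k m m'))
    ≡⟨ ∑₃-+₆ R₁ R₂ R₃ R₄ R₅ R₆ ⟩
  ∑₃ R₁ + (∑₃ R₂ + (∑₃ R₃ + (∑₃ R₄ + (∑₃ R₅ + ∑₃ R₆))))
    ≡⟨ cong (∑₃ R₁ +_) (cong₂ _+_ (∑₃-swap₂₃ R₂) (cong₂ _+_ (∑₃-swap₁₂ R₃)
         (cong₂ _+_ (trans (∑₃-swap₁₂ R₄) (∑₃-swap₂₃ (λ a b c → R₄ b a c)))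
         (cong₂ _+_ (trans (∑₃-swap₂₃ R₅) (∑₃-swap₁₂ (λ a b c → R₅ a c b)))
         (trans (∑₃-swap₂₃ R₆)
                (trans (∑₃-swap₁₂ (λ a b c → R₆ a c b)) (∑₃-swap₂₃ (λ a b c → R₆ b c a)))))))) ⟩
  ∑₃ (S (λ a b c → q a b c)) + (∑₃ (S (λ a b c → q a c b)) + (∑₃ (S (λ a b c → q b a c))
    + (∑₃ (S (λ a b c → q c a b)) + (∑₃ (S (λ a b c → q b c a)) + ∑₃ (S (λ a b c → q c b a))))))
    ≡⟨ sym (∑₃-+₆ (S (λ a b c → q a b c)) (S (λ a b c → q a c b)) (S (λ a b c → q b a c))
                  (S (λ a b c → q c a b)) (S (λ a b c → q b c a)) (S (λ a b c → q c b a))) ⟩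
  ∑₃ (λ a b c → sorted a b c (q a b c) + (sorted a b c (q a c b) + (sorted a b c (q b a c)
    + (sorted a b c (q c a b) + (sorted a b c (q b c a) + sorted a b c (q c b a))))))
    ≡⟨ sum-cong-≗ (λ a → sum-cong-≗ (λ b → sum-cong-≗ (λ c → collect a b c))) ⟩
  ∑₃ (λ a b c → sorted a b c (symmetrize q a b c))
    ≡⟨ sum-cong-≗ (λ a → sum-cong-≗ (λ b →
         sym (when-∑ (b ≺ a) (λ c → when (c ≺ b) (symmetrize q a b c))))) ⟩
  ∑[ a < n ] ∑[ b < n ] when (b ≺ a) (∑[ c < n ] when (c ≺ b) (symmetrize q a b c))
    ∎
  where
  R₁ R₂ R₃ R₄ R₅ R₆ : Fin n → Fin n → Fin n → ℚ
  R₁ k m m' = sorted k m m' (q k m m')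
  R₂ k m m' = sorted k m' m (q k m m')
  R₃ k m m' = sorted m k m' (q k m m')
  R₄ k m m' = sorted m m' k (q k m m')
  R₅ k m m' = sorted m' k m (q k m m')
  R₆ k m m' = sorted m' m k (q k m m')
  S : (Fin n → Fin n → Fin n → ℚ) → Fin n → Fin n → Fin n → ℚ
  S r a b c = sorted a b c (r a b c)
  collect : ∀ a b c → sorted a b c (q a b c) + (sorted a b c (q a c b) + (sorted a b c (q b a c)
    + (sorted a b c (q c a b) + (sorted a b c (q b c a) + sorted a b c (q c b a)))))
    ≡ sorted a b c (symmetrize q a b c)
  collect a b c with b ≺ a | c ≺ b
  ... | true  | true  = refl
  ... | true  | false = refl
  ... | false | _     = refl

-- Generators supported on two or three players

weight : ℕ × Bool → ℚ
weight (w , b) = if b then ℕtoℚ w else 0ℚ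

module _ {n : ℕ} (τ : Tournament n) where

  triangleCandidates : Fin n → Fin n → Fin n → List (ℕ × Bool)
  triangleCandidates i j k =
    (1 , isNeutral τ (comp i j ∷ comp j k ∷ comp i k ∷ [])) ∷
    (1 , isNeutral τ (comp i j ∷ coll i k ∷ coll j k ∷ [])) ∷
    (1 , isNeutral τ (comp i k ∷ coll i j ∷ coll j k ∷ [])) ∷
    (1 , isNeutral τ (comp j k ∷ coll i j ∷ coll i k ∷ [])) ∷ []

  clover : Bool → Game n → Game n → Bool
  clover iWins l lp = (iWins ∧ τ l ∧ not (τ lp)) ∨ (not iWins ∧ not (τ l) ∧ τ lp)

  pairCandidates : RootSystem → Fin n → Fin n → List (ℕ × Bool)
  pairCandidates B i j =
    (1 , isNeutral τ (half i ∷ half j ∷ comp i j ∷ [])) ∷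
    (1 , isNeutral τ (half i ∷ half j ∷ coll i j ∷ [])) ∷ []
  pairCandidates C i j =
    (2 , clover (τ (comp i j)) (coll i j) (loop i)) ∷
    (2 , clover (not (τ (comp i j))) (coll i j) (loop j)) ∷ []
  pairCandidates D i j = []

  triangleCount : Fin n → Fin n → Fin n → ℚ
  triangleCount i j k = sumOver (triangleCandidates i j k) weight

  pairCount : RootSystem → Fin n → Fin n → ℚ
  pairCount Φ i j = sumOver (pairCandidates Φ i j) weight

-- A triple of players a > b > c, renamed 2 > 1 > 0; the vector lists the outcomes of
-- comp 2 1, comp 1 0, comp 2 0, coll 2 1, coll 2 0, coll 1 0.
onTriangle : Vec Bool 6 → Tournament 3
onTriangle (x₂₁ ∷ x₁₀ ∷ x₂₀ ∷ y₂₁ ∷ y₂₀ ∷ y₁₀ ∷ []) = λ where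
  (comp 2F 1F) → x₂₁
  (comp 1F 0F) → x₁₀
  (comp 2F 0F) → x₂₀
  (coll 2F 1F) → y₂₁
  (coll 2F 0F) → y₂₀
  (coll 1F 0F) → y₁₀
  _            → false

-- A pair of players i > j, renamed 1 > 0; the vector lists the outcomes of
-- comp 1 0, coll 1 0, half 1, half 0, loop 1, loop 0.
onPair : Vec Bool 6 → Tournament 2
onPair (x ∷ y ∷ h₁ ∷ h₀ ∷ l₁ ∷ l₀ ∷ []) = λ where
  (comp 1F 0F) → x
  (coll 1F 0F) → y
  (half 1F)    → h₁
  (half 0F)    → h₀
  (loop 1F)    → l₁
  (loop 0F)    → l₀
  _            → false

every : ∀ m → (Vec Bool m → Bool) → Bool
every zero    p = p []
every (suc m) p = every m (λ v → p (true ∷ v)) ∧ every m (λ v → p (false ∷ v))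

every-sound : ∀ m (p : Vec Bool m → Bool) → T (every m p) → ∀ v → T (p v)
every-sound zero    p h []          = h
every-sound (suc m) p h (true  ∷ v) = every-sound m _ (proj₁ (Equivalence.to T-∧ h)) v
every-sound (suc m) p h (false ∷ v) = every-sound m _ (proj₂ (Equivalence.to T-∧ h)) v

≡-by-exhaustion : ∀ {m} (f g : Vec Bool m → ℚ) →
  T (every m (λ v → isYes (f v ℚP.≟ g v))) → ∀ v → f v ≡ g v
≡-by-exhaustion f g h v = toWitness (every-sound _ _ h v)

-- f and g are read off the statement; the last argument is checked by evaluating all 2⁶ cases.
triangle-identity : ∀ v →
  triangleCount (onTriangle v) 2F 1F 0F ≡ symmetrize (tripleTerm (onTriangle v)) 2F 1F 0F * ½
triangle-identity = ≡-by-exhaustion _ _ _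

pair-identity : ∀ Φ v →
  pairCount (onPair v) Φ 1F 0F ≡ (pairTerm (onPair v) Φ 1F 0F + pairTerm (onPair v) Φ 0F 1F) * ½
pair-identity B = ≡-by-exhaustion _ _ _
pair-identity C = ≡-by-exhaustion _ _ _
pair-identity D = ≡-by-exhaustion _ _ _

-- Neutrality is decided at the players involved

allB-sound : ∀ {A : Set} (p : A → Bool) {xs x} → allB p xs ≡ true → x ∈ xs → p x ≡ true
allB-sound p {y ∷ _} h (here refl) with p y
... | true = refl
allB-sound p {y ∷ _} h (there x∈xs) with p y
... | true = allB-sound p h x∈xs

allB-complete : ∀ {A : Set} (p : A → Bool) xs → (∀ {x} → x ∈ xs → p x ≡ true) → allB p xs ≡ true
allB-complete p []       h = refl
allB-complete p (x ∷ xs) h rewrite h (here refl) = allB-complete p xs (h ∘ there)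

allB-allFin : ∀ {n} (p : Fin n → Bool) (ks : List (Fin n)) →
  (∀ {k} → k ∉ ks → p k ≡ true) → allB p (allFin n) ≡ allB p ks
allB-allFin {n} p ks outside = ⇔→≡ (mk⇔ restrict extend)
  where
  restrict : allB p (allFin n) ≡ true → allB p ks ≡ true
  restrict h = allB-complete p ks (λ _ → allB-sound p h (∈-allFin _))
  extend : allB p ks ≡ true → allB p (allFin n) ≡ true
  extend h = allB-complete p (allFin n) (λ {k} _ → true-at k)
    where
    true-at : ∀ k → p k ≡ true
    true-at k with DecMembership._∈?_ _≟_ k ks
    ... | yes k∈ks = allB-sound p h k∈ks
    ... | no  k∉ks = outside k∉ks

scoreOf-vanishes : ∀ {n} (τ : Tournament n) X k → All (λ g → vec g k ≡ 0ℚ) X → scoreOf τ X k ≡ 0ℚ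
scoreOf-vanishes τ []      k []       = refl
scoreOf-vanishes τ (g ∷ X) k (g₀ ∷ X₀)
  rewrite g₀ | ℚP.*-zeroʳ (outcome (τ g)) | scoreOf-vanishes τ X k X₀ = refl

isNeutral-local : ∀ {n} (τ : Tournament n) X ks →
  (∀ {k} → All (_≢ k) ks → All (λ g → vec g k ≡ 0ℚ) X) →
  isNeutral τ X ≡ allB (λ k → does (scoreOf τ X k ℚP.≟ 0ℚ)) ks
isNeutral-local τ X ks off = allB-allFin _ ks λ k∉ks →
  cong (λ q → does (q ℚP.≟ 0ℚ)) (scoreOf-vanishes τ X _ (off (All.map ≢-sym (¬Any⇒All¬ _ k∉ks))))

module _ {n} {i j k : Fin n} (i≢k : i ≢ k) (j≢k : j ≢ k) where
  comp-off : vec (comp i j) k ≡ 0ℚ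
  comp-off rewrite ==-≢ i≢k | ==-≢ j≢k = refl
  coll-off : vec (coll i j) k ≡ 0ℚ
  coll-off rewrite ==-≢ i≢k | ==-≢ j≢k = refl

half-off : ∀ {n} {i k : Fin n} → i ≢ k → vec (half i) k ≡ 0ℚ
half-off i≢k rewrite ==-≢ i≢k = refl

module _ {n} (τ : Tournament n) {a b c : Fin n} (c<b : c < b) (b<a : b < a) where

  private
    c<a : c < a
    c<a = <-trans c<b b<a

  triangleView : Vec Bool 6
  triangleView =
    τ (comp a b) ∷ τ (comp b c) ∷ τ (comp a c) ∷ τ (coll a b) ∷ τ (coll a c) ∷ τ (coll b c) ∷ []

  -- Once neutrality is tested only at c, b, a (in the order of allFin 3 = 0, 1, 2) and the
  -- comparisons among a, b, c are evaluated, both sides are the same expression in the outcomes.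
  triangleCount-onTriangle : triangleCount τ a b c ≡ triangleCount (onTriangle triangleView) 2F 1F 0F
  triangleCount-onTriangle
    rewrite isNeutral-local τ (comp a b ∷ comp b c ∷ comp a c ∷ []) (c ∷ b ∷ a ∷ [])
              (λ { (c≢ ∷ b≢ ∷ a≢ ∷ []) →
                   comp-off a≢ b≢ ∷ comp-off b≢ c≢ ∷ comp-off a≢ c≢ ∷ [] })
          | isNeutral-local τ (comp a b ∷ coll a c ∷ coll b c ∷ []) (c ∷ b ∷ a ∷ [])
              (λ { (c≢ ∷ b≢ ∷ a≢ ∷ []) →
                   comp-off a≢ b≢ ∷ coll-off a≢ c≢ ∷ coll-off b≢ c≢ ∷ [] })
          | isNeutral-local τ (comp a c ∷ coll a b ∷ coll b c ∷ []) (c ∷ b ∷ a ∷ [])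
              (λ { (c≢ ∷ b≢ ∷ a≢ ∷ []) →
                   comp-off a≢ c≢ ∷ coll-off a≢ b≢ ∷ coll-off b≢ c≢ ∷ [] })
          | isNeutral-local τ (comp b c ∷ coll a b ∷ coll a c ∷ []) (c ∷ b ∷ a ∷ [])
              (λ { (c≢ ∷ b≢ ∷ a≢ ∷ []) →
                   comp-off b≢ c≢ ∷ coll-off a≢ b≢ ∷ coll-off a≢ c≢ ∷ [] })
          | ==-refl a | ==-refl b | ==-refl c
          | ==-≢ (<⇒≢ c<b) | ==-≢ (<⇒≢ b<a) | ==-≢ (<⇒≢ c<a)
          | ==-≢ (≢-sym (<⇒≢ c<b)) | ==-≢ (≢-sym (<⇒≢ b<a)) | ==-≢ (≢-sym (<⇒≢ c<a))
    = refl

  symmetrize-onTriangle :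
    symmetrize (tripleTerm τ) a b c ≡ symmetrize (tripleTerm (onTriangle triangleView)) 2F 1F 0F
  symmetrize-onTriangle
    rewrite ≺-true c<b | ≺-true b<a | ≺-true c<a
          | ≺-asym c<b | ≺-asym b<a | ≺-asym c<a
          | ==-≢ (<⇒≢ c<b) | ==-≢ (<⇒≢ b<a) | ==-≢ (<⇒≢ c<a)
          | ==-≢ (≢-sym (<⇒≢ c<b)) | ==-≢ (≢-sym (<⇒≢ b<a)) | ==-≢ (≢-sym (<⇒≢ c<a))
    = refl

module _ {n} (τ : Tournament n) {i j : Fin n} (j<i : j < i) where

  pairView : Vec Bool 6
  pairView = τ (comp i j) ∷ τ (coll i j) ∷ τ (half i) ∷ τ (half j) ∷ τ (loop i) ∷ τ (loop j) ∷ []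

  pairCount-onPair : ∀ Φ → pairCount τ Φ i j ≡ pairCount (onPair pairView) Φ 1F 0F
  pairCount-onPair B
    rewrite isNeutral-local τ (half i ∷ half j ∷ comp i j ∷ []) (j ∷ i ∷ [])
              (λ { (j≢ ∷ i≢ ∷ []) → half-off i≢ ∷ half-off j≢ ∷ comp-off i≢ j≢ ∷ [] })
          | isNeutral-local τ (half i ∷ half j ∷ coll i j ∷ []) (j ∷ i ∷ [])
              (λ { (j≢ ∷ i≢ ∷ []) → half-off i≢ ∷ half-off j≢ ∷ coll-off i≢ j≢ ∷ [] })
          | ==-refl i | ==-refl j | ==-≢ (<⇒≢ j<i) | ==-≢ (≢-sym (<⇒≢ j<i))
    = refl
  pairCount-onPair C = refl
  pairCount-onPair D = refl

  pairTerms-onPair : ∀ Φ → pairTerm τ Φ i j + pairTerm τ Φ j i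
                         ≡ pairTerm (onPair pairView) Φ 1F 0F + pairTerm (onPair pairView) Φ 0F 1F
  pairTerms-onPair B rewrite ≺-true j<i | ≺-asym j<i = refl
  pairTerms-onPair C rewrite ≺-true j<i | ≺-asym j<i = refl
  pairTerms-onPair D rewrite ≺-true j<i | ≺-asym j<i = refl

triangle-local : ∀ {n} (τ : Tournament n) {a b c} → c < b → b < a →
  triangleCount τ a b c ≡ symmetrize (tripleTerm τ) a b c * ½
triangle-local τ {a} {b} {c} c<b b<a = begin
  triangleCount τ a b c
    ≡⟨ triangleCount-onTriangle τ c<b b<a ⟩
  triangleCount (onTriangle v) 2F 1F 0F
    ≡⟨ triangle-identity v ⟩
  symmetrize (tripleTerm (onTriangle v)) 2F 1F 0F * ½
    ≡⟨ cong (_* ½) (sym (symmetrize-onTriangle τ c<b b<a)) ⟩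
  symmetrize (tripleTerm τ) a b c * ½
    ∎
  where v = triangleView τ c<b b<a

pair-local : ∀ Φ {n} (τ : Tournament n) {i j} → j < i →
  pairCount τ Φ i j ≡ (pairTerm τ Φ i j + pairTerm τ Φ j i) * ½
pair-local Φ τ {i} {j} j<i = begin
  pairCount τ Φ i j
    ≡⟨ pairCount-onPair τ j<i Φ ⟩
  pairCount (onPair v) Φ 1F 0F
    ≡⟨ pair-identity Φ v ⟩
  (pairTerm (onPair v) Φ 1F 0F + pairTerm (onPair v) Φ 0F 1F) * ½
    ≡⟨ cong (_* ½) (sym (pairTerms-onPair τ j<i Φ)) ⟩
  (pairTerm τ Φ i j + pairTerm τ Φ j i) * ½
    ∎
  where v = pairView τ j<i

-- The degree as a sum over pairs and triples of players

ℕtoℚ≡mkℚ : ∀ k → ℕtoℚ k ≡ mkℚ (ℤ.+ k) 0 (Coprime.sym (Coprime.1-coprimeTo k))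
ℕtoℚ≡mkℚ k = ℚP.normalize-coprime (Coprime.sym (Coprime.1-coprimeTo k))

ℕtoℚ-+ : ∀ m n → ℕtoℚ (m ℕ.+ n) ≡ ℕtoℚ m + ℕtoℚ n
ℕtoℚ-+ m n rewrite ℕtoℚ≡mkℚ m | ℕtoℚ≡mkℚ n = ℚP./-cong numerators refl
  where
  numerators : ℤ.+ (m ℕ.+ n) ≡ ℤ.+ m ℤ.* ℤ.+ 1 ℤ.+ ℤ.+ n ℤ.* ℤ.+ 1
  numerators = trans (ℤP.pos-+ m n) (sym (cong₂ ℤ._+_ (ℤP.*-identityʳ (ℤ.+ m)) (ℤP.*-identityʳ (ℤ.+ n))))

degree-as-sum : ∀ Φ {n} (τ : Tournament n) →
  ℕtoℚ (intGrDegree Φ τ) ≡ sumOver (generatorCandidates Φ τ) weight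
degree-as-sum Φ τ = go (generatorCandidates Φ τ)
  where
  go : ∀ xs → ℕtoℚ (foldr (λ { (w , b) acc → if b then w ℕ.+ acc else acc }) 0 xs) ≡ sumOver xs weight
  go []                = refl
  go ((w , true)  ∷ xs) = trans (ℕtoℚ-+ w _) (cong (ℕtoℚ w +_) (go xs))
  go ((w , false) ∷ xs) = trans (go xs) (sym (ℚP.+-identityˡ _))

module _ {n : ℕ} (τ : Tournament n) where

  trianglesTotal : ℚ
  trianglesTotal = ∑[ a < n ] ∑[ b < n ] when (b ≺ a) (∑[ c < n ] when (c ≺ b) (triangleCount τ a b c))

  pairsTotal : RootSystem → ℚ
  pairsTotal Φ = ∑[ i < n ] ∑[ j < n ] when (j ≺ i) (pairCount τ Φ i j)

  pairGenerators : RootSystem → List (ℕ × Bool)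
  pairGenerators B = concatMap (λ { (i , j) → pairCandidates τ B i j }) (pairs n)
  pairGenerators C = concatMap (λ { (i , j) → pairCandidates τ C i j }) (pairs n)
  pairGenerators D = []

  triangleGenerators : List (ℕ × Bool)
  triangleGenerators = concatMap (λ { (i , j , k) → triangleCandidates τ i j k }) (triples n)

  generatorCandidates-split : ∀ Φ → generatorCandidates Φ τ ≡ triangleGenerators ++ pairGenerators Φ
  generatorCandidates-split B = refl
  generatorCandidates-split C = refl
  generatorCandidates-split D = refl

  pairGenerators-sum : ∀ Φ → sumOver (pairGenerators Φ) weight ≡ pairsTotal Φ
  pairGenerators-sum B = trans (sumOver-concatMap _ (pairs n) weight) (pairs-sum n _)
  pairGenerators-sum C = trans (sumOver-concatMap _ (pairs n) weight) (pairs-sum n _)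
  pairGenerators-sum D = sym (begin
    ∑[ i < n ] ∑[ j < n ] when (j ≺ i) 0ℚ
      ≡⟨ sum-cong-≗ {n} (λ i → trans (sum-cong-≗ {n} (λ j → when-0 (j ≺ i))) (sum-replicate-zero n)) ⟩
    ∑[ i < n ] 0ℚ
      ≡⟨ sum-replicate-zero n ⟩
    0ℚ
      ∎)

  generators-split : ∀ Φ → sumOver (generatorCandidates Φ τ) weight ≡ trianglesTotal + pairsTotal Φ
  generators-split Φ = begin
    sumOver (generatorCandidates Φ τ) weight
      ≡⟨ cong (λ xs → sumOver xs weight) (generatorCandidates-split Φ) ⟩
    sumOver (triangleGenerators ++ pairGenerators Φ) weight
      ≡⟨ sumOver-++ triangleGenerators (pairGenerators Φ) weight ⟩
    sumOver triangleGenerators weight + sumOver (pairGenerators Φ) weight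
      ≡⟨ cong₂ _+_ (trans (sumOver-concatMap _ (triples n) weight) (triples-sum n _)) (pairGenerators-sum Φ) ⟩
    trianglesTotal + pairsTotal Φ
      ∎

module _ {n : ℕ} (τ : Tournament n) where

  triangles-half : trianglesTotal τ ≡ ∑₃ (tripleTerm τ) * ½
  triangles-half = begin
    ∑[ a < n ] ∑[ b < n ] when (b ≺ a) (∑[ c < n ] when (c ≺ b) (triangleCount τ a b c))
      ≡⟨ sum-cong-≗ (λ a → sum-cong-≗ (λ b → when-cong (b ≺ a) (λ b≺a → sum-cong-≗ (λ c →
           when-cong (c ≺ b) (λ c≺b → triangle-local τ {a} {b} {c} (≺⇒< c b c≺b) (≺⇒< b a b≺a)))))) ⟩
    ∑[ a < n ] ∑[ b < n ] when (b ≺ a) (∑[ c < n ] when (c ≺ b) (S a b c * ½))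
      ≡⟨ sum-cong-≗ (λ a → sum-cong-≗ (λ b →
           cong (when (b ≺ a)) (sym (∑-when-*ʳ (_≺ b) (S a b) ½)))) ⟩
    ∑[ a < n ] ∑[ b < n ] when (b ≺ a) ((∑[ c < n ] when (c ≺ b) (S a b c)) * ½)
      ≡⟨ sum-cong-≗ (λ a → sym (∑-when-*ʳ (_≺ a) (λ b → ∑[ c < n ] when (c ≺ b) (S a b c)) ½)) ⟩
    ∑[ a < n ] ((∑[ b < n ] when (b ≺ a) (∑[ c < n ] when (c ≺ b) (S a b c))) * ½)
      ≡⟨ sym (*-distribʳ-sum ½ (λ a → ∑[ b < n ] when (b ≺ a) (∑[ c < n ] when (c ≺ b) (S a b c)))) ⟩
    (∑[ a < n ] ∑[ b < n ] when (b ≺ a) (∑[ c < n ] when (c ≺ b) (S a b c))) * ½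
      ≡⟨ cong (_* ½) (sym (∑-triples (tripleTerm τ) qkkm qkmk qkmm)) ⟩
    ∑₃ (tripleTerm τ) * ½
      ∎
    where
    S : Fin n → Fin n → Fin n → ℚ
    S = symmetrize (tripleTerm τ)
    qkkm : ∀ k m → tripleTerm τ k k m ≡ 0ℚ
    qkkm k m rewrite pairPart-diagonal (lost ∘ τ) k with m == k
    ... | true  = refl
    ... | false = ℚP.*-zeroˡ (wonPart τ k m)
    qkmk : ∀ k m → tripleTerm τ k m k ≡ 0ℚ
    qkmk k m rewrite pairPart-diagonal (won ∘ τ) k with k == m
    ... | true  = refl
    ... | false = ℚP.*-zeroʳ (lostPart τ k m)
    qkmm : ∀ k m → tripleTerm τ k m m ≡ 0ℚ
    qkmm k m rewrite ==-refl m = refl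

  pairs-half : ∀ Φ → pairsTotal τ Φ ≡ (∑[ k < n ] ∑[ m < n ] pairTerm τ Φ k m) * ½
  pairs-half Φ = begin
    ∑[ i < n ] ∑[ j < n ] when (j ≺ i) (pairCount τ Φ i j)
      ≡⟨ sum-cong-≗ (λ i → sum-cong-≗ (λ j →
           when-cong (j ≺ i) (λ j≺i → pair-local Φ τ {i} {j} (≺⇒< j i j≺i)))) ⟩
    ∑[ i < n ] ∑[ j < n ] when (j ≺ i) (P i j * ½)
      ≡⟨ sum-cong-≗ (λ i → sym (∑-when-*ʳ (_≺ i) (P i) ½)) ⟩
    ∑[ i < n ] ((∑[ j < n ] when (j ≺ i) (P i j)) * ½)
      ≡⟨ sym (*-distribʳ-sum ½ (λ i → ∑[ j < n ] when (j ≺ i) (P i j))) ⟩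
    (∑[ i < n ] ∑[ j < n ] when (j ≺ i) (P i j)) * ½
      ≡⟨ cong (_* ½) (sym (∑-pairs (pairTerm τ Φ) diagonal)) ⟩
    (∑[ k < n ] ∑[ m < n ] pairTerm τ Φ k m) * ½
      ∎
    where
    P : Fin n → Fin n → ℚ
    P i j = pairTerm τ Φ i j + pairTerm τ Φ j i
    diagonal : ∀ k → pairTerm τ Φ k k ≡ 0ℚ
    diagonal k rewrite pairPart-diagonal (lost ∘ τ) k | pairPart-diagonal (won ∘ τ) k =
      solve 2 (λ w ℓ → con 0ℚ :* con 0ℚ :+ (con 0ℚ :* w :+ ℓ :* con 0ℚ) := con 0ℚ) refl
        (soloPart Φ (won ∘ τ) k) (soloPart Φ (lost ∘ τ) k)

theorem3p3 : (Φ : RootSystem) (n : ℕ) → 2 ≤ n →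
    (T : Tournament n) →
    ℕtoℚ (intGrDegree Φ T) ≡ dΦ Φ n (score Φ T)
theorem3p3 Φ n _ τ = begin
  ℕtoℚ (intGrDegree Φ τ)
    ≡⟨ degree-as-sum Φ τ ⟩
  sumOver (generatorCandidates Φ τ) weight
    ≡⟨ generators-split τ Φ ⟩
  trianglesTotal τ + pairsTotal τ Φ
    ≡⟨ cong₂ _+_ (triangles-half τ) (pairs-half τ Φ) ⟩
  T₃ * ½ + P₂ * ½
    ≡⟨ solve 2 (λ t p → t :* con ½ :+ p :* con ½ := (p :+ t) :* con ½) refl T₃ P₂ ⟩
  (P₂ + T₃) * ½
    ≡⟨ cong (_* ½) (sym (norm-difference Φ τ)) ⟩
  dΦ Φ n (score Φ τ)
    ∎
  where
  P₂ T₃ : ℚ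
  P₂ = ∑[ k < n ] ∑[ m < n ] pairTerm τ Φ k m
  T₃ = ∑₃ (tripleTerm τ)
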